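{- Let $(W,S)$ be a Coxeter system, $J\subseteq S$, $v\in W$, $s\in S$, and $\tau\in W/W_J$ such that $v<sv$, $svW_J\le\tau$, and $s\tau\le\tau$. Let $y=\mathrm{up}(sv,\tau)$ and $w=\mathrm{up}(v,\tau)$. Then $y=w$ or $y=sw>w$, and the latter holds only if $s\tau=\tau$.
   Context: $W_J$ is the subgroup generated by $J$; the Bruhat order on $W/W_J$ is transported from the minimal length coset representatives; $W$ acts on $W/W_J$ on the left. For $u\in W$ and $\tau\in W/W_J$ with $uW_J\le\tau$, $\mathrm{up}(u,\tau)$ denotes the Bruhat minimum of $\{w\in W: u\le w,\ wW_J=\tau\}$ (which exists by Deodhar). -}

module Defs where

open import Level using (0ℓ)
open import Algebra.Bundles using (Group)
open import Algebra.Morphism.Structures using (module GroupMorphisms)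
open import Data.Nat using (ℕ; zero; suc; _≤_; _<_)
open import Data.List using (List; []; _∷_; length)
open import Data.List.Relation.Unary.All using (All)
open import Data.Product using (Σ; ∃; ∃₂; _×_; _,_)
open import Relation.Nullary using (¬_)
open import Relation.Binary.PropositionalEquality using (_≡_; _≢_)
open import Relation.Unary using (Pred)

module _ (G : Group 0ℓ 0ℓ) where
  open Group G

  pow : Carrier → ℕ → Carrier
  pow x zero    = ε
  pow x (suc n) = x ∙ pow x n

  prod : {I : Set} → (I → Carrier) → List I → Carrier
  prod f []       = ε
  prod f (i ∷ is) = f i ∙ prod f is

-- Coxeter matrices and Coxeter systems
-- m i j = 0 encodes m(s_i,s_j) = ∞ (the relation (s_i s_j)^0 = 1 is vacuous).

record CoxeterMatrix (I : Set) : Set where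
  field
    m      : I → I → ℕ
    m-diag : ∀ i → m i i ≡ 1
    m-sym  : ∀ i j → m i j ≡ m j i
    m-off  : ∀ i j → i ≢ j → m i j ≢ 1

-- (W,S) with S = {gen i | i ∈ I}: W is generated by S and is presented by
-- ⟨ S | (s_i s_j)^{m i j} = 1 ⟩ (given by the universal property of the presentation).
record CoxeterSystem (I : Set) (M : CoxeterMatrix I) : Set₁ where
  open CoxeterMatrix M
  field
    W   : Group 0ℓ 0ℓ
    gen : I → Group.Carrier W
  open Group W
  field
    relations : ∀ i j → pow W (gen i ∙ gen j) (m i j) ≈ ε
    generated : ∀ w → ∃ λ (ws : List I) → prod W gen ws ≈ w
    universal : (G : Group 0ℓ 0ℓ) (f : I → Group.Carrier G) →
                (∀ i j → Group._≈_ G (pow G (Group._∙_ G (f i) (f j)) (m i j)) (Group.ε G)) →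
                Σ (Carrier → Group.Carrier G) λ φ →
                  GroupMorphisms.IsGroupHomomorphism (Group.rawGroup W) (Group.rawGroup G) φ
                  × (∀ i → Group._≈_ G (φ (gen i)) (f i))

module _ {I : Set} {M : CoxeterMatrix I} (C : CoxeterSystem I M) where
  open CoxeterSystem C
  open Group W

  s : I → Carrier
  s = gen

  IsLength : Carrier → ℕ → Set
  IsLength w n = (∃ λ ws → length ws ≡ n × prod W gen ws ≈ w)
               × (∀ ws → prod W gen ws ≈ w → n ≤ length ws)

  LenLt : Carrier → Carrier → Set
  LenLt x y = ∃₂ λ a b → IsLength x a × IsLength y b × a < b

  LenLe : Carrier → Carrier → Set
  LenLe x y = ∃₂ λ a b → IsLength x a × IsLength y b × a ≤ b

  Reflection : Carrier → Set
  Reflection t = ∃₂ λ w i → t ≈ (w ∙ gen i) ∙ w ⁻¹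

  data _≤B_ : Carrier → Carrier → Set where
    ≤B-base : ∀ {x y} → x ≈ y → x ≤B y
    ≤B-step : ∀ {x y t z} → x ≤B y → Reflection t → LenLt y (y ∙ t) → y ∙ t ≈ z → x ≤B z

  _<B_ : Carrier → Carrier → Set
  x <B y = x ≤B y × ¬ (x ≈ y)

  InW : Pred I 0ℓ → Carrier → Set
  InW J x = ∃ λ ws → All J ws × prod W gen ws ≈ x

  -- cosets in W/W_J are represented by elements; x W_J = y W_J
  SameCoset : Pred I 0ℓ → Carrier → Carrier → Set
  SameCoset J x y = InW J (x ⁻¹ ∙ y)

  MinRep : Pred I 0ℓ → Carrier → Carrier → Set
  MinRep J x r = SameCoset J x r × (∀ z → SameCoset J x z → LenLe r z)

  CosetLe : Pred I 0ℓ → Carrier → Carrier → Set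
  CosetLe J x y = ∃₂ λ rx ry → MinRep J x rx × MinRep J y ry × rx ≤B ry

  -- y = up(u, τ) where τ = t W_J: the Bruhat minimum of { w | u ≤ w, w W_J = τ }
  IsUp : Pred I 0ℓ → Carrier → Carrier → Carrier → Set
  IsUp J u t y = (u ≤B y × SameCoset J y t)
               × (∀ z → u ≤B z → SameCoset J z t → y ≤B z)

  Elt : Set
  Elt = Carrier

  mul : Carrier → Carrier → Carrier
  mul = _∙_

  Eq : Carrier → Carrier → Set
  Eq = _≈_

module Submission where

-- With v ≤ sv ≤ y and yW_J = τ, minimality of w gives w ≤ y, and the lifting property of the
-- Bruhat order does the rest. If sw < w then sv ≤ w, so y ≤ w and y = w. If sw > w and sτ = τ,
-- then sv ≤ sw ∈ τ, so w ≤ y ≤ sw with ℓ(sw) = ℓ(w) + 1. Finally sw > w and sτ < τ cannot happen: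
-- if r, r′ are the minimal representatives of sτ and τ, then sr ∈ τ has length ≤ ℓ(r) + 1 ≤ ℓ(r′),
-- so it is minimal in τ and has the left descent s; and a left descent of the minimal
-- representative m is one of every mu with u ∈ W_J, because ℓ(mu) = ℓ(m) + ℓ_J(u).
--
-- The Coxeter combinatorics comes from the presentation alone: the universal property applied to
-- W ⋉ (W → Bool) yields the cocycle η with η w t = [ℓ(wt) < ℓ(w)], which gives the strong exchange
-- property and with it the lifting property. Excluded middle decides equality in W (to define η)
-- and selects words of least length.

open import Algebra.Bundles using (Group)
open import Algebra.Morphism.Structures using (module GroupMorphisms)
import Algebra.Properties.Group as GroupProperties
open import Algebra.Structures using (IsGroup)
open import Axiom.ExcludedMiddle using (ExcludedMiddle)
open import Data.Bool using (Bool; true; false; _xor_)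
open import Data.Bool.Properties using (xor-assoc; xor-identityʳ; xor-same)
open import Data.Empty using (⊥-elim)
open import Data.List using (List; []; _∷_; _++_; _∷ʳ_; length; reverse)
open import Data.List.Properties using (length-++; unfold-reverse)
open import Data.List.Relation.Unary.All using (All; []; _∷_)
open import Data.List.Relation.Unary.All.Properties using (++⁺; ∷ʳ⁺; ∷ʳ⁻)
open import Data.List.Reverse using (Reverse; reverseView; []; _∶_∶ʳ_)
open import Data.Nat using (ℕ; zero; suc; _+_; _≤_; _<_; s≤s)
open import Data.Nat.Induction using (<-rec)
open import Data.Nat.Properties
  using (+-suc; +-identityʳ; +-comm; +-monoˡ-<; n≤1+n; ≤-refl; ≤-reflexive; ≤-trans; ≤-antisym; ≤-pred;
         <-trans; <-≤-trans; <-irrefl; <-asym; <⇒≤; <⇒≱; ≮⇒≥; module ≤-Reasoning)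
open import Data.Product using (Σ; ∃; _×_; _,_; proj₁; proj₂)
open import Data.Sum using (_⊎_; inj₁; inj₂)
open import Function.Bundles using (mk⇔)
open import Function.Definitions using (Congruent)
open import Level using (0ℓ; _⊔_)
open import Relation.Binary.PropositionalEquality as ≡ using (_≡_)
import Relation.Binary.Reasoning.Setoid as SetoidReasoning
open import Relation.Nullary using (yes; no; does; ¬_)
open import Relation.Nullary.Decidable using (does-⇔; dec-true)
open import Relation.Unary using (Pred)
open import Defs

module Conjugation {c ℓ} (G : Group c ℓ) where
  open Group G
  open GroupProperties G
  open SetoidReasoning setoid

  conj : Carrier → Carrier → Carrier
  conj b t = b ∙ t ∙ b ⁻¹

  conj-cong : ∀ {b b′ t t′} → b ≈ b′ → t ≈ t′ → conj b t ≈ conj b′ t′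
  conj-cong b≈b′ t≈t′ = ∙-cong (∙-cong b≈b′ t≈t′) (⁻¹-cong b≈b′)

  conj-∙ : ∀ b c t → conj (b ∙ c) t ≈ conj b (conj c t)
  conj-∙ b c t = begin
    b ∙ c ∙ t ∙ (b ∙ c) ⁻¹       ≈⟨ ∙-cong (assoc b c t) (⁻¹-anti-homo-∙ b c) ⟩
    b ∙ (c ∙ t) ∙ (c ⁻¹ ∙ b ⁻¹)  ≈⟨ assoc (b ∙ (c ∙ t)) (c ⁻¹) (b ⁻¹) ⟨
    b ∙ (c ∙ t) ∙ c ⁻¹ ∙ b ⁻¹    ≈⟨ ∙-congʳ (assoc b (c ∙ t) (c ⁻¹)) ⟩
    conj b (conj c t)            ∎

  conj-ε : ∀ t → conj ε t ≈ t
  conj-ε t = begin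
    ε ∙ t ∙ ε ⁻¹ ≈⟨ ∙-cong (identityˡ t) ε⁻¹≈ε ⟩
    t ∙ ε        ≈⟨ identityʳ t ⟩
    t            ∎

  conj-∙-ε : ∀ {b c} t → b ∙ c ≈ ε → conj b (conj c t) ≈ t
  conj-∙-ε {b} {c} t bc≈ε = begin
    conj b (conj c t) ≈⟨ conj-∙ b c t ⟨
    conj (b ∙ c) t    ≈⟨ conj-cong bc≈ε refl ⟩
    conj ε t          ≈⟨ conj-ε t ⟩
    t                 ∎

  conj-inverseˡ : ∀ b t → conj (b ⁻¹) (conj b t) ≈ t
  conj-inverseˡ b t = conj-∙-ε t (inverseˡ b)

  conj-inverseʳ : ∀ b t → conj b (conj (b ⁻¹) t) ≈ t
  conj-inverseʳ b t = conj-∙-ε t (inverseʳ b)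

  conj-transpose : ∀ {b t u} → conj b t ≈ u → t ≈ conj (b ⁻¹) u
  conj-transpose {b} {t} p = trans (sym (conj-inverseˡ b t)) (conj-cong refl p)

  conj-transpose⁻ : ∀ {b t u} → t ≈ conj (b ⁻¹) u → conj b t ≈ u
  conj-transpose⁻ {b} {u = u} p = trans (conj-cong refl p) (conj-inverseʳ b u)

  conj≈⇒∙≈∙ : ∀ {b t u} → conj b t ≈ u → b ∙ t ≈ u ∙ b
  conj≈⇒∙≈∙ {b} {t} p = trans (sym (//-rightDividesˡ b (b ∙ t))) (∙-congʳ p)

  conj-homo : ∀ b x y → conj b (x ∙ y) ≈ conj b x ∙ conj b y
  conj-homo b x y = begin
    b ∙ (x ∙ y) ∙ b ⁻¹                  ≈⟨ ∙-congʳ (assoc b x y) ⟨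
    b ∙ x ∙ y ∙ b ⁻¹                    ≈⟨ assoc (b ∙ x) y (b ⁻¹) ⟩
    b ∙ x ∙ (y ∙ b ⁻¹)                  ≈⟨ ∙-congˡ (∙-congʳ (\\-leftDividesʳ b y)) ⟨
    b ∙ x ∙ (b ⁻¹ ∙ (b ∙ y) ∙ b ⁻¹)      ≈⟨ ∙-congˡ (assoc (b ⁻¹) (b ∙ y) (b ⁻¹)) ⟩
    b ∙ x ∙ (b ⁻¹ ∙ (b ∙ y ∙ b ⁻¹))      ≈⟨ assoc (b ∙ x) (b ⁻¹) (b ∙ y ∙ b ⁻¹) ⟨
    b ∙ x ∙ b ⁻¹ ∙ (b ∙ y ∙ b ⁻¹)        ∎

-- A homomorphism into this group whose first component is the identity has as second component a
-- cocycle: f (a b) t = f b t xor f a (b t b⁻¹).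
module CocycleGroup {c ℓ} (G : Group c ℓ) where
  open Group G
  open Conjugation G

  BoolFun : Set (c ⊔ ℓ)
  BoolFun = Σ (Carrier → Bool) (Congruent _≈_ _≡_)

  Element : Set (c ⊔ ℓ)
  Element = Carrier × BoolFun

  _≋_ : Element → Element → Set (c ⊔ ℓ)
  (a , f , _) ≋ (b , g , _) = a ≈ b × (∀ t → f t ≡ g t)

  infixl 7 _⊛_
  _⊛_ : Element → Element → Element
  (a , f , f-cong) ⊛ (b , g , g-cong) =
    a ∙ b , (λ t → g t xor f (conj b t)) ,
    λ t≈t′ → ≡.cong₂ _xor_ (g-cong t≈t′) (f-cong (conj-cong refl t≈t′))

  e : Element
  e = ε , (λ _ → false) , λ _ → ≡.refl

  _⁻¹⊛ : Element → Element
  (a , f , f-cong) ⁻¹⊛ = a ⁻¹ , (λ t → f (conj (a ⁻¹) t)) , λ t≈t′ → f-cong (conj-cong refl t≈t′)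

  ⋉-isGroup : IsGroup _≋_ _⊛_ e _⁻¹⊛
  ⋉-isGroup = record
    { isMonoid = record
      { isSemigroup = record
        { isMagma = record
          { isEquivalence = record
            { refl  = refl , λ _ → ≡.refl
            ; sym   = λ (p , q) → sym p , λ t → ≡.sym (q t)
            ; trans = λ (p , q) (p′ , q′) → trans p p′ , λ t → ≡.trans (q t) (q′ t)
            }
          ; ∙-cong = λ {x x′ y y′} → ⊛-cong {x} {x′} {y} {y′}
          }
        ; assoc = ⊛-assoc
        }
      ; identity = (λ (a , f , _) → identityˡ a , λ t → xor-identityʳ (f t))
                 , (λ (a , _ , f-cong) → identityʳ a , λ t → f-cong (conj-ε t))
      }
    ; inverse = (λ (a , f , f-cong) → inverseˡ a , λ t →
                  ≡.trans (≡.cong (f t xor_) (f-cong (conj-inverseˡ a t))) (xor-same (f t)))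
              , (λ (a , f , _) → inverseʳ a , λ t → xor-same (f (conj (a ⁻¹) t)))
    ; ⁻¹-cong = λ { {a , f , f-cong} (p , q) →
                  ⁻¹-cong p , λ t → ≡.trans (f-cong (conj-cong (⁻¹-cong p) refl)) (q _) }
    }
    where
    ⊛-cong : ∀ {x x′ y y′} → x ≋ x′ → y ≋ y′ → (x ⊛ y) ≋ (x′ ⊛ y′)
    ⊛-cong {_ , _ , f-cong} (a≈a′ , f≗f′) (b≈b′ , g≗g′) =
      ∙-cong a≈a′ b≈b′ , λ t → ≡.cong₂ _xor_ (g≗g′ t) (≡.trans (f-cong (conj-cong b≈b′ refl)) (f≗f′ _))

    ⊛-assoc : ∀ x y z → (x ⊛ y ⊛ z) ≋ (x ⊛ (y ⊛ z))
    ⊛-assoc (a , f , f-cong) (b , g , _) (c , k , _) = assoc a b c , λ t →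
      ≡.trans (≡.cong (λ z → k t xor (g (conj c t) xor z)) (f-cong (sym (conj-∙ b c t))))
              (≡.sym (xor-assoc (k t) _ _))

  ⋉-group : Group (c ⊔ ℓ) (c ⊔ ℓ)
  ⋉-group = record { isGroup = ⋉-isGroup }

module Products (G : Group 0ℓ 0ℓ) where
  open Group G
  open GroupProperties G
  open SetoidReasoning setoid

  prod-++ : ∀ {A : Set} (f : A → Carrier) as bs → prod G f (as ++ bs) ≈ prod G f as ∙ prod G f bs
  prod-++ f []       bs = sym (identityˡ _)
  prod-++ f (a ∷ as) bs = trans (∙-congˡ (prod-++ f as bs)) (sym (assoc _ _ _))

  pow-cong : ∀ {a b} n → a ≈ b → pow G a n ≈ pow G b n
  pow-cong zero    a≈b = refl
  pow-cong (suc n) a≈b = ∙-cong a≈b (pow-cong n a≈b)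

  pow-+ : ∀ a m n → pow G a (m + n) ≈ pow G a m ∙ pow G a n
  pow-+ a zero    n = sym (identityˡ _)
  pow-+ a (suc m) n = trans (∙-congˡ (pow-+ a m n)) (sym (assoc _ _ _))

  pow-comm : ∀ a n → a ∙ pow G a n ≈ pow G a n ∙ a
  pow-comm a zero    = trans (identityʳ a) (sym (identityˡ a))
  pow-comm a (suc n) = trans (∙-congˡ (pow-comm a n)) (sym (assoc _ _ _))

  pow-⁻¹ : ∀ a n → pow G a n ⁻¹ ≈ pow G (a ⁻¹) n
  pow-⁻¹ a zero    = ε⁻¹≈ε
  pow-⁻¹ a (suc n) = begin
    (a ∙ pow G a n) ⁻¹      ≈⟨ ⁻¹-cong (pow-comm a n) ⟩
    (pow G a n ∙ a) ⁻¹      ≈⟨ ⁻¹-anti-homo-∙ _ _ ⟩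
    a ⁻¹ ∙ pow G a n ⁻¹     ≈⟨ ∙-congˡ (pow-⁻¹ a n) ⟩
    a ⁻¹ ∙ pow G (a ⁻¹) n   ∎

parity : (ℕ → Bool) → ℕ → Bool
parity b zero    = false
parity b (suc n) = parity b n xor b n

parity-cong : ∀ {b b′} → (∀ k → b k ≡ b′ k) → ∀ n → parity b n ≡ parity b′ n
parity-cong b≗b′ zero    = ≡.refl
parity-cong b≗b′ (suc n) = ≡.cong₂ _xor_ (parity-cong b≗b′ n) (b≗b′ n)

parity-+ : ∀ b m n → parity b (m + n) ≡ parity b m xor parity (λ r → b (m + r)) n
parity-+ b m zero    rewrite +-identityʳ m = ≡.sym (xor-identityʳ (parity b m))
parity-+ b m (suc n) rewrite +-suc m n = begin
  parity b (m + n) xor b (m + n)                              ≡⟨ ≡.cong (_xor b (m + n)) (parity-+ b m n) ⟩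
  (parity b m xor parity (λ r → b (m + r)) n) xor b (m + n)   ≡⟨ xor-assoc (parity b m) _ _ ⟩
  parity b m xor (parity (λ r → b (m + r)) n xor b (m + n))   ∎
  where open ≡.≡-Reasoning

parity-pairs : ∀ b n → parity (λ k → b (k + k) xor b (suc (k + k))) n ≡ parity b (n + n)
parity-pairs b zero    = ≡.refl
parity-pairs b (suc n) rewrite +-suc n n =
  ≡.trans (≡.cong (_xor (b (n + n) xor b (suc (n + n)))) (parity-pairs b n))
          (≡.sym (xor-assoc (parity b (n + n)) _ _))

parity-periodic : ∀ b n → (∀ r → b (n + r) ≡ b r) → parity b (n + n) ≡ false
parity-periodic b n periodic = begin
  parity b (n + n)                             ≡⟨ parity-+ b n n ⟩
  parity b n xor parity (λ r → b (n + r)) n    ≡⟨ ≡.cong (parity b n xor_) (parity-cong periodic n) ⟩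
  parity b n xor parity b n                    ≡⟨ xor-same (parity b n) ⟩
  false                                        ∎
  where open ≡.≡-Reasoning

ℕ-least : ExcludedMiddle 0ℓ → (P : ℕ → Set) → ∀ {n} → P n → ∃ λ k → P k × (∀ j → P j → k ≤ j)
ℕ-least em P {n} = <-rec (λ n → P n → ∃ λ k → P k × (∀ j → P j → k ≤ j)) step n
  where
  step : ∀ n → (∀ {j} → j < n → P j → ∃ λ k → P k × (∀ j → P j → k ≤ j)) →
         P n → ∃ λ k → P k × (∀ j → P j → k ≤ j)
  step n rec Pn with em {∃ λ j → j < n × P j}
  ... | yes (j , j<n , Pj) = rec j<n Pj
  ... | no ∄smaller        = n , Pn , λ j Pj → ≮⇒≥ λ j<n → ∄smaller (j , j<n , Pj)

length-∷ʳ : ∀ {A : Set} (xs : List A) x → length (xs ∷ʳ x) ≡ suc (length xs)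
length-∷ʳ xs x = ≡.trans (length-++ xs) (+-comm (length xs) 1)

All-reverse : ∀ {A : Set} {P : A → Set} {xs} → All P xs → All P (reverse xs)
All-reverse {xs = []}     []         = []
All-reverse {xs = x ∷ xs} (Px ∷ Pxs) =
  ≡.subst (All _) (≡.sym (unfold-reverse x xs)) (∷ʳ⁺ (All-reverse Pxs) Px)

data Deletion {A : Set} : List A → List A → Set where
  here  : ∀ {a ws} → Deletion (a ∷ ws) ws
  there : ∀ {a ws ws′} → Deletion ws ws′ → Deletion (a ∷ ws) (a ∷ ws′)

length-deletion : ∀ {A : Set} {ws ws′ : List A} → Deletion ws ws′ → length ws ≡ suc (length ws′)
length-deletion here      = ≡.refl
length-deletion (there d) = ≡.cong suc (length-deletion d)

deletion-++ : ∀ {A : Set} (as bs : List A) {cs} → Deletion (as ++ bs) cs →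
  (∃ λ as′ → Deletion as as′ × cs ≡ as′ ++ bs) ⊎ (∃ λ bs′ → Deletion bs bs′ × cs ≡ as ++ bs′)
deletion-++ []       bs d         = inj₂ (_ , d , ≡.refl)
deletion-++ (a ∷ as) bs here      = inj₁ (as , here , ≡.refl)
deletion-++ (a ∷ as) bs (there d) with deletion-++ as bs d
... | inj₁ (as′ , d′ , ≡.refl) = inj₁ (a ∷ as′ , there d′ , ≡.refl)
... | inj₂ (bs′ , d′ , ≡.refl) = inj₂ (bs′ , d′ , ≡.refl)

All-deletion : ∀ {A : Set} {P : A → Set} {ws ws′} → All P ws → Deletion ws ws′ → All P ws′
All-deletion (_ ∷ Pws) here      = Pws
All-deletion (Pa ∷ Pws) (there d) = Pa ∷ All-deletion Pws d

module Coxeter (em : ExcludedMiddle 0ℓ) {I : Set} {M : CoxeterMatrix I} (C : CoxeterSystem I M) where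
  open CoxeterMatrix M
  open CoxeterSystem C
  open Group W
  open GroupProperties W
  open Conjugation W
  open Products W
  open CocycleGroup W using (BoolFun; _≋_; _⊛_; ⋉-group)
  open GroupMorphisms (Group.rawGroup W) (Group.rawGroup ⋉-group) using (IsGroupHomomorphism)

  decide : Set → Bool
  decide A = does (em {A})

  decide-⇔ : ∀ {A B} → (A → B) → (B → A) → decide A ≡ decide B
  decide-⇔ to from = does-⇔ (mk⇔ to from) em em

  decide-true : ∀ {A} → A → decide A ≡ true
  decide-true = dec-true em

  decide-sound : ∀ {A} → decide A ≡ true → A
  decide-sound {A} p with em {A}
  ... | yes a = a

  decide-≈ : ∀ {t t′ u u′} → t ≈ t′ → u ≈ u′ → decide (t ≈ u) ≡ decide (t′ ≈ u′)
  decide-≈ t≈t′ u≈u′ = decide-⇔ (λ p → trans (sym t≈t′) (trans p u≈u′))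
                               (λ p → trans t≈t′ (trans p (sym u≈u′)))

  decide-conj : ∀ {b t u v} → conj (b ⁻¹) u ≈ v → decide (conj b t ≈ u) ≡ decide (t ≈ v)
  decide-conj b⁻¹u≈v = decide-⇔ (λ p → trans (conj-transpose p) b⁻¹u≈v)
                                (λ p → conj-transpose⁻ (trans p (sym b⁻¹u≈v)))

  ⟦_⟧ : List I → Carrier
  ⟦_⟧ = prod W gen

  gen-involutive : ∀ i → gen i ∙ gen i ≈ ε
  gen-involutive i = trans (sym (identityʳ _))
    (≡.subst (λ k → pow W (gen i ∙ gen i) k ≈ ε) (m-diag i) (relations i i))

  gen⁻¹ : ∀ i → gen i ⁻¹ ≈ gen i
  gen⁻¹ i = sym (inverseʳ-unique (gen i) (gen i) (gen-involutive i))

  ⟦⟧-++ : ∀ as bs → ⟦ as ++ bs ⟧ ≈ ⟦ as ⟧ ∙ ⟦ bs ⟧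
  ⟦⟧-++ = prod-++ gen

  ⟦⟧-reverse : ∀ ws → ⟦ reverse ws ⟧ ≈ ⟦ ws ⟧ ⁻¹
  ⟦⟧-reverse []       = sym ε⁻¹≈ε
  ⟦⟧-reverse (a ∷ ws) rewrite unfold-reverse a ws = begin
    ⟦ reverse ws ∷ʳ a ⟧          ≈⟨ ⟦⟧-++ (reverse ws) (a ∷ []) ⟩
    ⟦ reverse ws ⟧ ∙ (gen a ∙ ε) ≈⟨ ∙-cong (⟦⟧-reverse ws) (trans (identityʳ _) (sym (gen⁻¹ a))) ⟩
    ⟦ ws ⟧ ⁻¹ ∙ gen a ⁻¹         ≈⟨ ⁻¹-anti-homo-∙ _ _ ⟨
    (gen a ∙ ⟦ ws ⟧) ⁻¹          ∎
    where open SetoidReasoning setoid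

  ⟦⟧-∷ʳ : ∀ ws i → ⟦ ws ∷ʳ i ⟧ ≈ ⟦ ws ⟧ ∙ gen i
  ⟦⟧-∷ʳ ws i = trans (⟦⟧-++ ws (i ∷ [])) (∙-congˡ (identityʳ _))

  isGen : I → BoolFun
  isGen i = (λ t → decide (t ≈ gen i)) , λ t≈t′ → decide-≈ t≈t′ refl

  gen⋉ : I → Group.Carrier ⋉-group
  gen⋉ i = gen i , isGen i

  module DihedralRelation (i j : I) where
    x y : Carrier
    x = gen i ∙ gen j
    y = gen j ∙ gen i

    F : Carrier → Bool
    F = proj₁ (proj₂ (gen⋉ i ⊛ gen⋉ j))

    pow⋉ : ℕ → Group.Carrier ⋉-group
    pow⋉ = pow ⋉-group (gen⋉ i ⊛ gen⋉ j)

    pow⋉-fst : ∀ n → proj₁ (pow⋉ n) ≡ pow W x n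
    pow⋉-fst zero    = ≡.refl
    pow⋉-fst (suc n) = ≡.cong (x ∙_) (pow⋉-fst n)

    pow⋉-snd : ∀ n t → proj₁ (proj₂ (pow⋉ n)) t ≡ parity (λ k → F (conj (pow W x k) t)) n
    pow⋉-snd zero    t = ≡.refl
    pow⋉-snd (suc n) t = ≡.cong₂ _xor_ (pow⋉-snd n t) (≡.cong (λ z → F (conj z t)) (pow⋉-fst n))

    xᵏ⁻¹≈yᵏ : ∀ k → pow W x k ⁻¹ ≈ pow W y k
    xᵏ⁻¹≈yᵏ k = trans (pow-⁻¹ x k) (pow-cong k (trans (⁻¹-anti-homo-∙ _ _) (∙-cong (gen⁻¹ j) (gen⁻¹ i))))

    sⱼxᵏ≈yᵏsⱼ : ∀ k → gen j ∙ pow W x k ≈ pow W y k ∙ gen j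
    sⱼxᵏ≈yᵏsⱼ zero    = trans (identityʳ _) (sym (identityˡ _))
    sⱼxᵏ≈yᵏsⱼ (suc k) = begin
      gen j ∙ (x ∙ pow W x k)          ≈⟨ assoc _ _ _ ⟨
      gen j ∙ x ∙ pow W x k            ≈⟨ ∙-congʳ (assoc _ _ _) ⟨
      y ∙ gen j ∙ pow W x k            ≈⟨ assoc _ _ _ ⟩
      y ∙ (gen j ∙ pow W x k)          ≈⟨ ∙-congˡ (sⱼxᵏ≈yᵏsⱼ k) ⟩
      y ∙ (pow W y k ∙ gen j)          ≈⟨ assoc _ _ _ ⟨
      y ∙ pow W y k ∙ gen j            ∎
      where open SetoidReasoning setoid

    conj-x⁻ᵏ-sⱼ : ∀ k → conj (pow W x k ⁻¹) (gen j) ≈ pow W y (k + k) ∙ gen j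
    conj-x⁻ᵏ-sⱼ k = begin
      pow W x k ⁻¹ ∙ gen j ∙ pow W x k ⁻¹ ⁻¹   ≈⟨ ∙-congˡ (⁻¹-involutive _) ⟩
      pow W x k ⁻¹ ∙ gen j ∙ pow W x k        ≈⟨ assoc _ _ _ ⟩
      pow W x k ⁻¹ ∙ (gen j ∙ pow W x k)      ≈⟨ ∙-cong (xᵏ⁻¹≈yᵏ k) (sⱼxᵏ≈yᵏsⱼ k) ⟩
      pow W y k ∙ (pow W y k ∙ gen j)         ≈⟨ assoc _ _ _ ⟨
      pow W y k ∙ pow W y k ∙ gen j           ≈⟨ ∙-congʳ (pow-+ y k k) ⟨
      pow W y (k + k) ∙ gen j                 ∎
      where open SetoidReasoning setoid

    conj-x⁻ᵏsⱼ-sᵢ : ∀ k → conj ((gen j ∙ pow W x k) ⁻¹) (gen i) ≈ pow W y (suc (k + k)) ∙ gen j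
    conj-x⁻ᵏsⱼ-sᵢ k = begin
      (gen j ∙ pow W x k) ⁻¹ ∙ gen i ∙ (gen j ∙ pow W x k) ⁻¹ ⁻¹
        ≈⟨ ∙-cong (∙-congʳ (⁻¹-anti-homo-∙ _ _)) (⁻¹-involutive _) ⟩
      pow W x k ⁻¹ ∙ gen j ⁻¹ ∙ gen i ∙ (gen j ∙ pow W x k)
        ≈⟨ ∙-cong (∙-congʳ (∙-cong (xᵏ⁻¹≈yᵏ k) (gen⁻¹ j))) (sⱼxᵏ≈yᵏsⱼ k) ⟩
      pow W y k ∙ gen j ∙ gen i ∙ (pow W y k ∙ gen j)
        ≈⟨ ∙-congʳ (assoc _ _ _) ⟩
      pow W y k ∙ y ∙ (pow W y k ∙ gen j)
        ≈⟨ ∙-congʳ (pow-comm y k) ⟨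
      y ∙ pow W y k ∙ (pow W y k ∙ gen j)
        ≈⟨ assoc _ _ _ ⟨
      pow W y (suc k) ∙ pow W y k ∙ gen j
        ≈⟨ ∙-congʳ (pow-+ y (suc k) k) ⟨
      pow W y (suc (k + k)) ∙ gen j
        ∎
      where open SetoidReasoning setoid

    isYʳsⱼ : Carrier → ℕ → Bool
    isYʳsⱼ t r = decide (t ≈ pow W y r ∙ gen j)

    F-conj-xᵏ : ∀ t k → F (conj (pow W x k) t) ≡ isYʳsⱼ t (k + k) xor isYʳsⱼ t (suc (k + k))
    F-conj-xᵏ t k = ≡.cong₂ _xor_
      (decide-conj (conj-x⁻ᵏ-sⱼ k))
      (≡.trans (decide-≈ (sym (conj-∙ (gen j) (pow W x k) t)) refl) (decide-conj (conj-x⁻ᵏsⱼ-sᵢ k)))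

    isYʳsⱼ-periodic : ∀ {n} → pow W x n ≈ ε → ∀ t r → isYʳsⱼ t (n + r) ≡ isYʳsⱼ t r
    isYʳsⱼ-periodic {n} xⁿ≈ε t r = decide-≈ refl (∙-congʳ (begin
      pow W y (n + r)          ≈⟨ pow-+ y n r ⟩
      pow W y n ∙ pow W y r    ≈⟨ ∙-congʳ (trans (sym (xᵏ⁻¹≈yᵏ n)) (trans (⁻¹-cong xⁿ≈ε) ε⁻¹≈ε)) ⟩
      ε ∙ pow W y r            ≈⟨ identityˡ _ ⟩
      pow W y r                ∎))
      where open SetoidReasoning setoid

    -- F(xᵏ t x⁻ᵏ) tests t against the two reflections y²ᵏsⱼ, y²ᵏ⁺¹sⱼ, so the second component of
    -- (gen⋉ i ⊛ gen⋉ j)ⁿ counts t among y⁰sⱼ, …, y²ⁿ⁻¹sⱼ: two full periods when yⁿ = ε.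
    relation : ∀ n → pow W x n ≈ ε → pow⋉ n ≋ Group.ε ⋉-group
    relation n xⁿ≈ε = ≡.subst (_≈ ε) (≡.sym (pow⋉-fst n)) xⁿ≈ε , λ t → begin
      proj₁ (proj₂ (pow⋉ n)) t                  ≡⟨ pow⋉-snd n t ⟩
      parity (λ k → F (conj (pow W x k) t)) n   ≡⟨ parity-cong (F-conj-xᵏ t) n ⟩
      parity (λ k → isYʳsⱼ t (k + k) xor isYʳsⱼ t (suc (k + k))) n
                                                ≡⟨ parity-pairs (isYʳsⱼ t) n ⟩
      parity (isYʳsⱼ t) (n + n)                 ≡⟨ parity-periodic (isYʳsⱼ t) n (isYʳsⱼ-periodic {n} xⁿ≈ε t) ⟩
      false                                     ∎
      where open ≡.≡-Reasoning

  ⋉-relations : ∀ i j → pow ⋉-group (gen⋉ i ⊛ gen⋉ j) (m i j) ≋ Group.ε ⋉-group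
  ⋉-relations i j = DihedralRelation.relation i j (m i j) (relations i j)

  φ : Carrier → Group.Carrier ⋉-group
  φ = proj₁ (universal ⋉-group gen⋉ ⋉-relations)

  φ-hom : IsGroupHomomorphism φ
  φ-hom = proj₁ (proj₂ (universal ⋉-group gen⋉ ⋉-relations))

  φ-gen : ∀ i → φ (gen i) ≋ gen⋉ i
  φ-gen = proj₂ (proj₂ (universal ⋉-group gen⋉ ⋉-relations))

  module φ = IsGroupHomomorphism φ-hom

  φ-fst : ∀ w → proj₁ (φ w) ≈ w
  φ-fst w with generated w
  ... | ws , ⟦ws⟧≈w = trans (proj₁ (φ.⟦⟧-cong (sym ⟦ws⟧≈w))) (trans (φ-fst-word ws) ⟦ws⟧≈w)
    where
    φ-fst-word : ∀ ws → proj₁ (φ ⟦ ws ⟧) ≈ ⟦ ws ⟧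
    φ-fst-word []       = proj₁ φ.ε-homo
    φ-fst-word (a ∷ ws) = trans (proj₁ (φ.homo (gen a) ⟦ ws ⟧)) (∙-cong (proj₁ (φ-gen a)) (φ-fst-word ws))

  -- For any word s₁⋯sₖ of w, η w t is the parity of the number of j with t = sₖ⋯sⱼ⋯sₖ;
  -- η-true⇒shorter and shorter⇒η-true identify it with [ℓ(w t) < ℓ(w)].
  η : Carrier → Carrier → Bool
  η w = proj₁ (proj₂ (φ w))

  η-congˡ : ∀ {a b} → a ≈ b → ∀ t → η a t ≡ η b t
  η-congˡ a≈b = proj₂ (φ.⟦⟧-cong a≈b)

  η-congʳ : ∀ w → Congruent _≈_ _≡_ (η w)
  η-congʳ w = proj₂ (proj₂ (φ w))

  η-∙ : ∀ a b t → η (a ∙ b) t ≡ η b t xor η a (conj b t)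
  η-∙ a b t = ≡.trans (proj₂ (φ.homo a b) t) (≡.cong (η b t xor_) (η-congʳ a (conj-cong (φ-fst b) refl)))

  η-ε : ∀ t → η ε t ≡ false
  η-ε = proj₂ φ.ε-homo

  η-⁻¹ : ∀ a t → η (a ⁻¹) t ≡ η a (conj (a ⁻¹) t)
  η-⁻¹ a t = ≡.trans (proj₂ (φ.⁻¹-homo a) t) (η-congʳ a (conj-cong (⁻¹-cong (φ-fst a)) refl))

  η-gen : ∀ i t → η (gen i) t ≡ decide (t ≈ gen i)
  η-gen i = proj₂ (φ-gen i)

  η-reflection : ∀ {t} → Reflection C t → η t t ≡ true
  η-reflection {t} (u , i , t≈ugu⁻¹) = begin
    η t t                                      ≡⟨ η-congˡ t≈ugu⁻¹ t ⟩
    η (u ∙ g ∙ u ⁻¹) t                         ≡⟨ η-∙ (u ∙ g) (u ⁻¹) t ⟩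
    η (u ⁻¹) t xor η (u ∙ g) (conj (u ⁻¹) t)   ≡⟨ ≡.cong₂ _xor_ (η-⁻¹ u t) (η-congʳ (u ∙ g) u⁻¹tu≈g) ⟩
    η u (conj (u ⁻¹) t) xor η (u ∙ g) g        ≡⟨ ≡.cong₂ _xor_ (η-congʳ u u⁻¹tu≈g) (η-∙ u g g) ⟩
    η u g xor (η g g xor η u (conj g g))
      ≡⟨ ≡.cong₂ (λ a b → η u g xor (a xor b)) (≡.trans (η-gen i g) (decide-true refl))
                                               (η-congʳ u (//-rightDividesʳ g g)) ⟩
    η u g xor (true xor η u g)                 ≡⟨ a-xor-true-xor-a (η u g) ⟩
    true                                       ∎
    where
    open ≡.≡-Reasoning
    g : Carrier
    g = gen i
    u⁻¹tu≈g : conj (u ⁻¹) t ≈ g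
    u⁻¹tu≈g = sym (conj-transpose (sym t≈ugu⁻¹))
    a-xor-true-xor-a : ∀ a → a xor (true xor a) ≡ true
    a-xor-true-xor-a false = ≡.refl
    a-xor-true-xor-a true  = ≡.refl

  gen-gen : ∀ i w → gen i ∙ (gen i ∙ w) ≈ w
  gen-gen i w = trans (sym (assoc _ _ _)) (trans (∙-congʳ (gen-involutive i)) (identityˡ w))

  reflection-involutive : ∀ {t} → Reflection C t → t ∙ t ≈ ε
  reflection-involutive {t} (u , i , t≈ugu⁻¹) = begin
    t ∙ t                          ≈⟨ ∙-cong t≈ugu⁻¹ t≈ugu⁻¹ ⟩
    conj u (gen i) ∙ conj u (gen i) ≈⟨ conj-homo u (gen i) (gen i) ⟨
    conj u (gen i ∙ gen i)         ≈⟨ conj-cong refl (gen-involutive i) ⟩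
    u ∙ ε ∙ u ⁻¹                   ≈⟨ ∙-congʳ (identityʳ u) ⟩
    u ∙ u ⁻¹                       ≈⟨ inverseʳ u ⟩
    ε                              ∎
    where open SetoidReasoning setoid

  ∙-reflection-cancel : ∀ {t} → Reflection C t → ∀ a → a ∙ t ∙ t ≈ a
  ∙-reflection-cancel r a = trans (assoc _ _ _) (trans (∙-congˡ (reflection-involutive r)) (identityʳ a))

  ∙-reflection-swap : ∀ {t x w} → Reflection C t → x ∙ t ≈ w → w ∙ t ≈ x
  ∙-reflection-swap {x = x} t-refl xt≈w = trans (∙-congʳ (sym xt≈w)) (∙-reflection-cancel t-refl x)

  rightReflection : Carrier → I → Carrier
  rightReflection w i = conj (w ⁻¹) (gen i)

  rightReflection-isReflection : ∀ w i → Reflection C (rightReflection w i)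
  rightReflection-isReflection w i = w ⁻¹ , i , refl

  ∙-rightReflection : ∀ w i → w ∙ rightReflection w i ≈ gen i ∙ w
  ∙-rightReflection w i = conj≈⇒∙≈∙ (conj-inverseʳ w (gen i))

  gen-isReflection : ∀ i → Reflection C (gen i)
  gen-isReflection i = ε , i , sym (trans (∙-cong (identityˡ _) ε⁻¹≈ε) (identityʳ _))

  gen-∙-∙-cancel : ∀ a w t → w ∙ t ≈ gen a ∙ w → gen a ∙ w ∙ t ≈ w
  gen-∙-∙-cancel a w t wt≈aw = trans (assoc _ _ _) (trans (∙-congˡ wt≈aw) (gen-gen a w))

  exchange : ∀ ws t → η ⟦ ws ⟧ t ≡ true → ∃ λ ws′ → Deletion ws ws′ × ⟦ ws′ ⟧ ≈ ⟦ ws ⟧ ∙ t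
  exchange []       t ηεt with ≡.trans (≡.sym (η-ε t)) ηεt
  ... | ()
  exchange (a ∷ ws) t η≡true with η ⟦ ws ⟧ t in η-ws
  ... | true  = let ws′ , d , ⟦ws′⟧≈⟦ws⟧t = exchange ws t η-ws in
                a ∷ ws′ , there d , trans (∙-congˡ ⟦ws′⟧≈⟦ws⟧t) (sym (assoc _ _ _))
  ... | false = ws , here , sym (gen-∙-∙-cancel a ⟦ ws ⟧ t (conj≈⇒∙≈∙ (decide-sound ⟦ws⟧t⟦ws⟧⁻¹≈a)))
    where
    ⟦ws⟧t⟦ws⟧⁻¹≈a : decide (conj ⟦ ws ⟧ t ≈ gen a) ≡ true
    ⟦ws⟧t⟦ws⟧⁻¹≈a = ≡.trans (≡.sym (η-gen a _))
      (≡.trans (≡.cong (_xor η (gen a) (conj ⟦ ws ⟧ t)) (≡.sym η-ws))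
               (≡.trans (≡.sym (η-∙ (gen a) ⟦ ws ⟧ t)) η≡true))

  deletion-reflection : ∀ {ws ws′} → Deletion ws ws′ → ∃ λ t → Reflection C t × ⟦ ws′ ⟧ ≈ ⟦ ws ⟧ ∙ t
  deletion-reflection {a ∷ ws} here =
    rightReflection ⟦ ws ⟧ a , rightReflection-isReflection ⟦ ws ⟧ a ,
    sym (gen-∙-∙-cancel a ⟦ ws ⟧ _ (∙-rightReflection ⟦ ws ⟧ a))
  deletion-reflection {a ∷ ws} (there d) =
    let t , t-refl , ⟦ws′⟧≈⟦ws⟧t = deletion-reflection d in
    t , t-refl , trans (∙-congˡ ⟦ws′⟧≈⟦ws⟧t) (sym (assoc _ _ _))

  length-exists : ∀ w → ∃ (IsLength C w)
  length-exists w with generated w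
  ... | ws , ⟦ws⟧≈w with ℕ-least em (λ n → ∃ λ ws → length ws ≡ n × ⟦ ws ⟧ ≈ w) (ws , ≡.refl , ⟦ws⟧≈w)
  ... | n , reduced , minimal = n , reduced , λ ws′ ⟦ws′⟧≈w → minimal (length ws′) (ws′ , ≡.refl , ⟦ws′⟧≈w)

  ℓ : Carrier → ℕ
  ℓ w = proj₁ (length-exists w)

  ℓ-isLength : ∀ w → IsLength C w (ℓ w)
  ℓ-isLength w = proj₂ (length-exists w)

  reducedWord : ∀ w → ∃ λ ws → length ws ≡ ℓ w × ⟦ ws ⟧ ≈ w
  reducedWord w = proj₁ (ℓ-isLength w)

  ℓ-minimal : ∀ {w} ws → ⟦ ws ⟧ ≈ w → ℓ w ≤ length ws
  ℓ-minimal {w} = proj₂ (ℓ-isLength w)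

  isLength⇒≡ℓ : ∀ {w n} → IsLength C w n → n ≡ ℓ w
  isLength⇒≡ℓ {w} {n} ((ws , length≡n , ⟦ws⟧≈w) , n-minimal) =
    let ws₀ , length≡ℓ , ⟦ws₀⟧≈w = reducedWord w in
    ≤-antisym (≡.subst (n ≤_) length≡ℓ (n-minimal ws₀ ⟦ws₀⟧≈w)) (≡.subst (ℓ w ≤_) length≡n (ℓ-minimal ws ⟦ws⟧≈w))

  ℓ-cong : ∀ {a b} → a ≈ b → ℓ a ≡ ℓ b
  ℓ-cong {a} {b} a≈b = isLength⇒≡ℓ (
    (let ws , length≡ℓ , ⟦ws⟧≈a = reducedWord a in ws , length≡ℓ , trans ⟦ws⟧≈a a≈b) ,
    λ ws ⟦ws⟧≈b → ℓ-minimal ws (trans ⟦ws⟧≈b (sym a≈b)))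

  LenLt⇒ℓ< : ∀ {a b} → LenLt C a b → ℓ a < ℓ b
  LenLt⇒ℓ< (_ , _ , a-length , b-length , lt) = ≡.subst₂ _<_ (isLength⇒≡ℓ a-length) (isLength⇒≡ℓ b-length) lt

  ℓ<⇒LenLt : ∀ {a b} → ℓ a < ℓ b → LenLt C a b
  ℓ<⇒LenLt {a} {b} lt = ℓ a , ℓ b , ℓ-isLength a , ℓ-isLength b , lt

  LenLe⇒ℓ≤ : ∀ {a b} → LenLe C a b → ℓ a ≤ ℓ b
  LenLe⇒ℓ≤ (_ , _ , a-length , b-length , le) = ≡.subst₂ _≤_ (isLength⇒≡ℓ a-length) (isLength⇒≡ℓ b-length) le

  ℓ-deletion : ∀ {w ws ws′} → length ws ≡ ℓ w → Deletion ws ws′ → ℓ ⟦ ws′ ⟧ < ℓ w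
  ℓ-deletion {ws′ = ws′} length≡ℓ d =
    ≡.subst (ℓ ⟦ ws′ ⟧ <_) (≡.trans (≡.sym (length-deletion d)) length≡ℓ) (s≤s (ℓ-minimal ws′ refl))

  ℓ-∙-⟦⟧ : ∀ x ws → ℓ (x ∙ ⟦ ws ⟧) ≤ ℓ x + length ws
  ℓ-∙-⟦⟧ x ws =
    let xs , length≡ℓ , ⟦xs⟧≈x = reducedWord x in
    ≡.subst (ℓ (x ∙ ⟦ ws ⟧) ≤_) (≡.trans (length-++ xs) (≡.cong (_+ length ws) length≡ℓ))
      (ℓ-minimal (xs ++ ws) (trans (⟦⟧-++ xs ws) (∙-congʳ ⟦xs⟧≈x)))

  η-true⇒shorter : ∀ {w t} → η w t ≡ true → ℓ (w ∙ t) < ℓ w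
  η-true⇒shorter {w} {t} ηwt≡true =
    let ws , length≡ℓ , ⟦ws⟧≈w = reducedWord w
        ws′ , d , ⟦ws′⟧≈⟦ws⟧t = exchange ws t (≡.trans (η-congˡ ⟦ws⟧≈w t) ηwt≡true)
    in ≡.subst (_< ℓ w) (ℓ-cong (trans ⟦ws′⟧≈⟦ws⟧t (∙-congʳ ⟦ws⟧≈w))) (ℓ-deletion length≡ℓ d)

  η-false⇒longer : ∀ {w t} → Reflection C t → η w t ≡ false → ℓ w < ℓ (w ∙ t)
  η-false⇒longer {w} {t} t-refl ηwt≡false =
    ≡.subst (_< ℓ (w ∙ t)) (ℓ-cong (∙-reflection-cancel t-refl w)) (η-true⇒shorter ηwtt≡true)
    where
    ηwtt≡true : η (w ∙ t) t ≡ true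
    ηwtt≡true = ≡.trans (η-∙ w t t)
      (≡.cong₂ _xor_ (η-reflection t-refl) (≡.trans (η-congʳ w (//-rightDividesʳ t t)) ηwt≡false))

  shorter⇒η-true : ∀ {w t} → Reflection C t → ℓ (w ∙ t) < ℓ w → η w t ≡ true
  shorter⇒η-true {w} {t} t-refl shorter with η w t in ηwt
  ... | true  = ≡.refl
  ... | false = ⊥-elim (<-asym shorter (η-false⇒longer t-refl ηwt))

  ℓ-∙-reflection : ∀ {w t} → Reflection C t → ℓ w < ℓ (w ∙ t) ⊎ ℓ (w ∙ t) < ℓ w
  ℓ-∙-reflection {w} {t} t-refl with η w t in ηwt
  ... | true  = inj₂ (η-true⇒shorter ηwt)
  ... | false = inj₁ (η-false⇒longer t-refl ηwt)

  strong-exchange : ∀ {w t} ws → Reflection C t → ℓ (w ∙ t) < ℓ w → ⟦ ws ⟧ ≈ w →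
                    ∃ λ ws′ → Deletion ws ws′ × ⟦ ws′ ⟧ ≈ w ∙ t
  strong-exchange {w} {t} ws t-refl shorter ⟦ws⟧≈w =
    let ws′ , d , ⟦ws′⟧≈⟦ws⟧t = exchange ws t (≡.trans (η-congˡ ⟦ws⟧≈w t) (shorter⇒η-true t-refl shorter))
    in ws′ , d , trans ⟦ws′⟧≈⟦ws⟧t (∙-congʳ ⟦ws⟧≈w)

  infix 4 _≤ᴮ_
  _≤ᴮ_ : Carrier → Carrier → Set
  _≤ᴮ_ = _≤B_ C

  ≤ᴮ-respʳ : ∀ {a b c} → a ≤ᴮ b → b ≈ c → a ≤ᴮ c
  ≤ᴮ-respʳ (≤B-base a≈b)              b≈c = ≤B-base (trans a≈b b≈c)
  ≤ᴮ-respʳ (≤B-step a≤y t-refl lt yt≈b) b≈c = ≤B-step a≤y t-refl lt (trans yt≈b b≈c)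

  ≤ᴮ-trans : ∀ {a b c} → a ≤ᴮ b → b ≤ᴮ c → a ≤ᴮ c
  ≤ᴮ-trans a≤b (≤B-base b≈c)              = ≤ᴮ-respʳ a≤b b≈c
  ≤ᴮ-trans a≤b (≤B-step b≤y t-refl lt yt≈c) = ≤B-step (≤ᴮ-trans a≤b b≤y) t-refl lt yt≈c

  ≤ᴮ-respˡ : ∀ {a b c} → a ≈ b → b ≤ᴮ c → a ≤ᴮ c
  ≤ᴮ-respˡ a≈b = ≤ᴮ-trans (≤B-base a≈b)

  ≤B-step-ℓ< : ∀ {y t z} → LenLt C y (y ∙ t) → y ∙ t ≈ z → ℓ y < ℓ z
  ≤B-step-ℓ< {y} y<yt yt≈z = ≡.subst (ℓ y <_) (ℓ-cong yt≈z) (LenLt⇒ℓ< y<yt)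

  ≤ᴮ⇒≈⊎ℓ< : ∀ {a b} → a ≤ᴮ b → a ≈ b ⊎ ℓ a < ℓ b
  ≤ᴮ⇒≈⊎ℓ< (≤B-base a≈b) = inj₁ a≈b
  ≤ᴮ⇒≈⊎ℓ< (≤B-step {y = y} a≤y _ lt yt≈b) with ≤ᴮ⇒≈⊎ℓ< a≤y
  ... | inj₁ a≈y = inj₂ (≡.subst (_< _) (ℓ-cong (sym a≈y)) (≤B-step-ℓ< lt yt≈b))
  ... | inj₂ a<y = inj₂ (<-trans a<y (≤B-step-ℓ< lt yt≈b))

  ≤ᴮ⇒ℓ≤ : ∀ {a b} → a ≤ᴮ b → ℓ a ≤ ℓ b
  ≤ᴮ⇒ℓ≤ a≤b with ≤ᴮ⇒≈⊎ℓ< a≤b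
  ... | inj₁ a≈b = ≤-reflexive (ℓ-cong a≈b)
  ... | inj₂ a<b = <⇒≤ a<b

  ≤ᴮ-antisym : ∀ {a b} → a ≤ᴮ b → b ≤ᴮ a → a ≈ b
  ≤ᴮ-antisym a≤b b≤a with ≤ᴮ⇒≈⊎ℓ< a≤b
  ... | inj₁ a≈b = a≈b
  ... | inj₂ a<b = ⊥-elim (<⇒≱ a<b (≤ᴮ⇒ℓ≤ b≤a))

  <ᴮ⇒ℓ< : ∀ {a b} → _<B_ C a b → ℓ a < ℓ b
  <ᴮ⇒ℓ< (a≤b , a≉b) with ≤ᴮ⇒≈⊎ℓ< a≤b
  ... | inj₁ a≈b = ⊥-elim (a≉b a≈b)
  ... | inj₂ a<b = a<b

  ≤ᴮ-cover : ∀ {w y z} → w ≤ᴮ y → y ≤ᴮ z → ℓ z ≡ suc (ℓ w) → y ≈ w ⊎ y ≈ z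
  ≤ᴮ-cover w≤y y≤z ℓz≡1+ℓw with ≤ᴮ⇒≈⊎ℓ< w≤y | ≤ᴮ⇒≈⊎ℓ< y≤z
  ... | inj₁ w≈y | _        = inj₁ (sym w≈y)
  ... | inj₂ _   | inj₁ y≈z = inj₂ y≈z
  ... | inj₂ w<y | inj₂ y<z = ⊥-elim (<⇒≱ w<y (≤-pred (≡.subst (_ <_) ℓz≡1+ℓw y<z)))

  ≤ᴮ-∙-reflection : ∀ {w t} → Reflection C t → ℓ w < ℓ (w ∙ t) → w ≤ᴮ w ∙ t
  ≤ᴮ-∙-reflection t-refl longer = ≤B-step (≤B-base refl) t-refl (ℓ<⇒LenLt longer) refl

  deletion-≤ᴮ : ∀ {w ws ws′} → length ws ≡ ℓ w → ⟦ ws ⟧ ≈ w → Deletion ws ws′ → ⟦ ws′ ⟧ ≤ᴮ w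
  deletion-≤ᴮ {w} {ws} {ws′} length≡ℓ ⟦ws⟧≈w d with deletion-reflection d
  ... | t , t-refl , ⟦ws′⟧≈⟦ws⟧t = ≤ᴮ-respʳ (≤ᴮ-∙-reflection t-refl longer) ⟦ws′⟧t≈w
    where
    ⟦ws′⟧t≈w : ⟦ ws′ ⟧ ∙ t ≈ w
    ⟦ws′⟧t≈w = trans (∙-congʳ ⟦ws′⟧≈⟦ws⟧t) (trans (∙-reflection-cancel t-refl ⟦ ws ⟧) ⟦ws⟧≈w)
    longer : ℓ ⟦ ws′ ⟧ < ℓ (⟦ ws′ ⟧ ∙ t)
    longer = ≡.subst (ℓ ⟦ ws′ ⟧ <_) (ℓ-cong (sym ⟦ws′⟧t≈w)) (ℓ-deletion length≡ℓ d)

  module LeftMultiplication (i : I) where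
    sᵢ : Carrier
    sᵢ = gen i

    Ascent Descent : Carrier → Set
    Ascent  w = ℓ w < ℓ (sᵢ ∙ w)
    Descent w = ℓ (sᵢ ∙ w) < ℓ w

    ℓ-sᵢ∙ : ∀ w → ℓ (sᵢ ∙ w) ≤ suc (ℓ w)
    ℓ-sᵢ∙ w = let ws , length≡ℓ , ⟦ws⟧≈w = reducedWord w in
      ≡.subst (λ n → ℓ (sᵢ ∙ w) ≤ suc n) length≡ℓ (ℓ-minimal (i ∷ ws) (∙-congˡ ⟦ws⟧≈w))

    ascent-ℓ : ∀ {w} → Ascent w → ℓ (sᵢ ∙ w) ≡ suc (ℓ w)
    ascent-ℓ {w} ascent = ≤-antisym (ℓ-sᵢ∙ w) ascent

    ascent⊎descent : ∀ w → Ascent w ⊎ Descent w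
    ascent⊎descent w with ℓ-∙-reflection (rightReflection-isReflection w i)
    ... | inj₁ longer  = inj₁ (≡.subst (ℓ w <_) (ℓ-cong (∙-rightReflection w i)) longer)
    ... | inj₂ shorter = inj₂ (≡.subst (_< ℓ w) (ℓ-cong (∙-rightReflection w i)) shorter)

    ascent-≤ᴮ : ∀ {w} → Ascent w → w ≤ᴮ sᵢ ∙ w
    ascent-≤ᴮ {w} ascent = ≤ᴮ-respʳ
      (≤ᴮ-∙-reflection (rightReflection-isReflection w i)
                       (≡.subst (ℓ w <_) (ℓ-cong (sym (∙-rightReflection w i))) ascent))
      (∙-rightReflection w i)

    ascent-<ᴮ : ∀ {w} → Ascent w → _<B_ C w (sᵢ ∙ w)
    ascent-<ᴮ ascent = ascent-≤ᴮ ascent , λ w≈sᵢw → <-irrefl (ℓ-cong w≈sᵢw) ascent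

    descent-≤ᴮ : ∀ {w} → Descent w → sᵢ ∙ w ≤ᴮ w
    descent-≤ᴮ {w} descent =
      ≤ᴮ-respʳ (ascent-≤ᴮ (≡.subst (ℓ (sᵢ ∙ w) <_) (ℓ-cong (sym (gen-gen i w))) descent)) (gen-gen i w)

    -- Strong exchange for t in the word sᵢ·(reduced word of sᵢ w) for w: deleting the leading sᵢ
    -- gives x = sᵢ w, any other deletion exhibits sᵢ x below sᵢ w.
    sᵢ∙-step : ∀ {x t w} → x ∙ t ≈ w → Reflection C t → ℓ x < ℓ w → w ≈ sᵢ ∙ x ⊎ sᵢ ∙ x ≤ᴮ sᵢ ∙ w
    sᵢ∙-step {x} {t} {w} xt≈w t-refl x<w
      using wt≈x ← ∙-reflection-swap t-refl xt≈w
      with reducedWord (sᵢ ∙ w)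
    ... | ws , length≡ℓ , ⟦ws⟧≈sᵢw
      with strong-exchange (i ∷ ws) t-refl (≡.subst (_< ℓ w) (ℓ-cong (sym wt≈x)) x<w)
                           (trans (∙-congˡ ⟦ws⟧≈sᵢw) (gen-gen i w))
    ... | _ , here , ⟦ws⟧≈wt =
      inj₁ (trans (sym (gen-gen i w)) (∙-congˡ (trans (sym ⟦ws⟧≈sᵢw) (trans ⟦ws⟧≈wt wt≈x))))
    ... | _ ∷ ws′ , there d , sᵢ⟦ws′⟧≈wt =
      inj₂ (≤ᴮ-respˡ (trans (∙-congˡ (sym (trans sᵢ⟦ws′⟧≈wt wt≈x))) (gen-gen i ⟦ ws′ ⟧))
                     (deletion-≤ᴮ length≡ℓ ⟦ws⟧≈sᵢw d))

    lifting : ∀ {u w} → u ≤ᴮ w → Ascent u → (Ascent w → sᵢ ∙ u ≤ᴮ sᵢ ∙ w) × (Descent w → sᵢ ∙ u ≤ᴮ w)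
    lifting (≤B-base u≈w) ascent-u =
      (λ _ → ≤B-base (∙-congˡ u≈w)) ,
      (λ descent-w → ⊥-elim (<-asym descent-w (≡.subst₂ _<_ (ℓ-cong u≈w) (ℓ-cong (∙-congˡ u≈w)) ascent-u)))
    lifting {u} {w} (≤B-step {y = x} u≤x t-refl x<xt xt≈w) ascent-u
      using x<w ← ≤B-step-ℓ< x<xt xt≈w
      with lifting u≤x ascent-u | sᵢ∙-step xt≈w t-refl x<w | ascent⊎descent x
    ... | up , _ | inj₁ w≈sᵢx | _ =
      (λ ascent-w → ⊥-elim (<-asym ascent-w (≡.subst (_< ℓ w) (ℓ-cong (sym sᵢw≈x)) x<w))) ,
      (λ _ → ≤ᴮ-respʳ (up (≡.subst (ℓ x <_) (ℓ-cong w≈sᵢx) x<w)) (sym w≈sᵢx))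
      where
      sᵢw≈x : sᵢ ∙ w ≈ x
      sᵢw≈x = trans (∙-congˡ w≈sᵢx) (gen-gen i x)
    ... | up , _ | inj₂ sᵢx≤sᵢw | inj₁ ascent-x =
      (λ _ → sᵢu≤sᵢw) , (λ descent-w → ≤ᴮ-trans sᵢu≤sᵢw (descent-≤ᴮ descent-w))
      where
      sᵢu≤sᵢw : sᵢ ∙ u ≤ᴮ sᵢ ∙ w
      sᵢu≤sᵢw = ≤ᴮ-trans (up ascent-x) sᵢx≤sᵢw
    ... | _ , down | inj₂ _ | inj₂ descent-x =
      (λ ascent-w → ≤ᴮ-trans sᵢu≤w (ascent-≤ᴮ ascent-w)) , (λ _ → sᵢu≤w)
      where
      sᵢu≤w : sᵢ ∙ u ≤ᴮ w
      sᵢu≤w = ≤ᴮ-trans (down descent-x) (≤B-step (≤B-base refl) t-refl x<xt xt≈w)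

  module Parabolic (J : Pred I 0ℓ) where
    InWJ : Carrier → Set
    InWJ = InW C J

    infix 4 _∼_
    _∼_ : Carrier → Carrier → Set
    _∼_ = SameCoset C J

    InWJ-resp : ∀ {x y} → x ≈ y → InWJ x → InWJ y
    InWJ-resp x≈y (ws , J-ws , ⟦ws⟧≈x) = ws , J-ws , trans ⟦ws⟧≈x x≈y

    InWJ-word : ∀ {ws} → All J ws → InWJ ⟦ ws ⟧
    InWJ-word J-ws = _ , J-ws , refl

    InWJ-ε : InWJ ε
    InWJ-ε = InWJ-word []

    InWJ-∙ : ∀ {x y} → InWJ x → InWJ y → InWJ (x ∙ y)
    InWJ-∙ (ws , J-ws , ⟦ws⟧≈x) (vs , J-vs , ⟦vs⟧≈y) =
      ws ++ vs , ++⁺ J-ws J-vs , trans (⟦⟧-++ ws vs) (∙-cong ⟦ws⟧≈x ⟦vs⟧≈y)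

    InWJ-⁻¹ : ∀ {x} → InWJ x → InWJ (x ⁻¹)
    InWJ-⁻¹ (ws , J-ws , ⟦ws⟧≈x) = reverse ws , All-reverse J-ws , trans (⟦⟧-reverse ws) (⁻¹-cong ⟦ws⟧≈x)

    ∼-reflexive : ∀ {x y} → x ≈ y → x ∼ y
    ∼-reflexive {x} x≈y = InWJ-resp (trans (sym (inverseˡ x)) (∙-congˡ x≈y)) InWJ-ε

    ∼-sym : ∀ {x y} → x ∼ y → y ∼ x
    ∼-sym {x} {y} x∼y = InWJ-resp (trans (⁻¹-anti-homo-∙ (x ⁻¹) y) (∙-congˡ (⁻¹-involutive x))) (InWJ-⁻¹ x∼y)

    ∼-trans : ∀ {x y z} → x ∼ y → y ∼ z → x ∼ z
    ∼-trans {x} {y} {z} x∼y y∼z = InWJ-resp (trans (assoc _ _ _) (∙-congˡ (\\-leftDividesˡ y z))) (InWJ-∙ x∼y y∼z)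

    ∼-resp : ∀ {x y z} → x ∼ y → y ≈ z → x ∼ z
    ∼-resp x∼y y≈z = ∼-trans x∼y (∼-reflexive y≈z)

    ∼-∙ˡ : ∀ g {x y} → x ∼ y → g ∙ x ∼ g ∙ y
    ∼-∙ˡ g {x} {y} = InWJ-resp (begin
      x ⁻¹ ∙ y                    ≈⟨ ∙-congˡ (\\-leftDividesʳ g y) ⟨
      x ⁻¹ ∙ (g ⁻¹ ∙ (g ∙ y))     ≈⟨ assoc _ _ _ ⟨
      x ⁻¹ ∙ g ⁻¹ ∙ (g ∙ y)       ≈⟨ ∙-congʳ (⁻¹-anti-homo-∙ g x) ⟨
      (g ∙ x) ⁻¹ ∙ (g ∙ y)        ∎)
      where open SetoidReasoning setoid

    ∼-∙ʳ : ∀ {x u} → InWJ u → x ∼ x ∙ u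
    ∼-∙ʳ {x} {u} = InWJ-resp (sym (\\-leftDividesʳ x u))

    MinimalInCoset : Carrier → Set
    MinimalInCoset m = ∀ z → m ∼ z → ℓ m ≤ ℓ z

    JReduced : List I → Set
    JReduced js = ∀ ks → All J ks → ⟦ ks ⟧ ≈ ⟦ js ⟧ → length js ≤ length ks

    minimal-deletion-leaves-coset : ∀ {m mw mw′} → MinimalInCoset m → length mw ≡ ℓ m → Deletion mw mw′ →
                                    ¬ (m ∼ ⟦ mw′ ⟧)
    minimal-deletion-leaves-coset {mw′ = mw′} m-min length≡ℓ d m∼⟦mw′⟧ =
      <⇒≱ (ℓ-deletion length≡ℓ d) (m-min ⟦ mw′ ⟧ m∼⟦mw′⟧)

    JReduced-init : ∀ {ks j} → All J (ks ∷ʳ j) → JReduced (ks ∷ʳ j) → JReduced ks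
    JReduced-init {ks} {j} J-ksj ksj-reduced ks′ J-ks′ ⟦ks′⟧≈⟦ks⟧ =
      ≤-pred (≡.subst₂ _≤_ (length-∷ʳ ks j) (length-∷ʳ ks′ j)
        (ksj-reduced (ks′ ∷ʳ j) (∷ʳ⁺ J-ks′ (proj₂ (∷ʳ⁻ J-ksj)))
          (trans (⟦⟧-∷ʳ ks′ j) (trans (∙-congʳ ⟦ks′⟧≈⟦ks⟧) (sym (⟦⟧-∷ʳ ks j))))))

    -- In the strong exchange for gen j in (reduced word of m) ++ ks, a deletion inside the first
    -- part contradicts minimality of m, a deletion inside ks contradicts J-reducedness of ks j.
    minimal∙J-ascent : ∀ {m} → MinimalInCoset m → ∀ ks j → All J (ks ∷ʳ j) → JReduced (ks ∷ʳ j) →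
                       ℓ (m ∙ ⟦ ks ⟧) < ℓ (m ∙ ⟦ ks ⟧ ∙ gen j)
    minimal∙J-ascent {m} m-min ks j J-ksj ksj-reduced
      with ℓ-∙-reflection {m ∙ ⟦ ks ⟧} (gen-isReflection j)
    ... | inj₁ ascent  = ascent
    ... | inj₂ descent
      with reducedWord m
    ... | mw , length≡ℓ , ⟦mw⟧≈m
      with strong-exchange (mw ++ ks) (gen-isReflection j) descent (trans (⟦⟧-++ mw ks) (∙-congʳ ⟦mw⟧≈m))
    ... | cs , d , ⟦cs⟧≈m⟦ks⟧g
      with deletion-++ mw ks d
    ... | inj₁ (mw′ , d′ , ≡.refl) =
      ⊥-elim (minimal-deletion-leaves-coset m-min length≡ℓ d′ (∼-resp (∼-∙ʳ conj-ks-g∈WJ) m∙conj≈⟦mw′⟧))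
      where
      conj-ks-g∈WJ : InWJ (conj ⟦ ks ⟧ (gen j))
      conj-ks-g∈WJ = InWJ-resp (∙-congʳ (⟦⟧-∷ʳ ks j))
        (InWJ-∙ (InWJ-word J-ksj) (InWJ-⁻¹ (InWJ-word (proj₁ (∷ʳ⁻ J-ksj)))))
      m∙conj≈⟦mw′⟧ : m ∙ conj ⟦ ks ⟧ (gen j) ≈ ⟦ mw′ ⟧
      m∙conj≈⟦mw′⟧ = begin
        m ∙ (⟦ ks ⟧ ∙ gen j ∙ ⟦ ks ⟧ ⁻¹)    ≈⟨ assoc _ _ _ ⟨
        m ∙ (⟦ ks ⟧ ∙ gen j) ∙ ⟦ ks ⟧ ⁻¹    ≈⟨ ∙-congʳ (assoc _ _ _) ⟨
        m ∙ ⟦ ks ⟧ ∙ gen j ∙ ⟦ ks ⟧ ⁻¹      ≈⟨ ∙-congʳ (trans (sym ⟦cs⟧≈m⟦ks⟧g) (⟦⟧-++ mw′ ks)) ⟩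
        ⟦ mw′ ⟧ ∙ ⟦ ks ⟧ ∙ ⟦ ks ⟧ ⁻¹        ≈⟨ //-rightDividesʳ ⟦ ks ⟧ ⟦ mw′ ⟧ ⟩
        ⟦ mw′ ⟧                            ∎
        where open SetoidReasoning setoid
    ... | inj₂ (ks′ , d′ , ≡.refl) =
      ⊥-elim (<⇒≱ shorter (ksj-reduced ks′ (All-deletion (proj₁ (∷ʳ⁻ J-ksj)) d′) ⟦ks′⟧≈⟦ksj⟧))
      where
      shorter : length ks′ < length (ks ∷ʳ j)
      shorter = ≡.subst (length ks′ <_) (≡.sym (length-∷ʳ ks j))
                  (s≤s (≡.subst (length ks′ ≤_) (≡.sym (length-deletion d′)) (n≤1+n _)))
      ⟦ks′⟧≈⟦ksj⟧ : ⟦ ks′ ⟧ ≈ ⟦ ks ∷ʳ j ⟧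
      ⟦ks′⟧≈⟦ksj⟧ = ∙-cancelˡ ⟦ mw ⟧ _ _ (begin
        ⟦ mw ⟧ ∙ ⟦ ks′ ⟧          ≈⟨ ⟦⟧-++ mw ks′ ⟨
        ⟦ mw ++ ks′ ⟧             ≈⟨ ⟦cs⟧≈m⟦ks⟧g ⟩
        m ∙ ⟦ ks ⟧ ∙ gen j        ≈⟨ ∙-congʳ (∙-congʳ ⟦mw⟧≈m) ⟨
        ⟦ mw ⟧ ∙ ⟦ ks ⟧ ∙ gen j   ≈⟨ assoc _ _ _ ⟩
        ⟦ mw ⟧ ∙ (⟦ ks ⟧ ∙ gen j) ≈⟨ ∙-congˡ (⟦⟧-∷ʳ ks j) ⟨
        ⟦ mw ⟧ ∙ ⟦ ks ∷ʳ j ⟧      ∎)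
        where open SetoidReasoning setoid

    ℓ-minimal∙J : ∀ {m} → MinimalInCoset m → ∀ {js} → All J js → JReduced js → ℓ m + length js ≤ ℓ (m ∙ ⟦ js ⟧)
    ℓ-minimal∙J {m} m-min {js} = go (reverseView js)
      where
      go : ∀ {js} → Reverse js → All J js → JReduced js → ℓ m + length js ≤ ℓ (m ∙ ⟦ js ⟧)
      go [] _ _ = ≡.subst₂ _≤_ (≡.sym (+-identityʳ (ℓ m))) (ℓ-cong (sym (identityʳ m))) ≤-refl
      go (ks ∶ rv ∶ʳ j) J-ksj ksj-reduced = begin
        ℓ m + length (ks ∷ʳ j)   ≡⟨ ≡.cong (ℓ m +_) (length-∷ʳ ks j) ⟩
        ℓ m + suc (length ks)    ≡⟨ +-suc (ℓ m) (length ks) ⟩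
        suc (ℓ m + length ks)    ≤⟨ s≤s (go rv (proj₁ (∷ʳ⁻ J-ksj)) (JReduced-init J-ksj ksj-reduced)) ⟩
        suc (ℓ (m ∙ ⟦ ks ⟧))     ≤⟨ minimal∙J-ascent m-min ks j J-ksj ksj-reduced ⟩
        ℓ (m ∙ ⟦ ks ⟧ ∙ gen j)   ≡⟨ ℓ-cong (trans (assoc _ _ _) (∙-congˡ (sym (⟦⟧-∷ʳ ks j)))) ⟩
        ℓ (m ∙ ⟦ ks ∷ʳ j ⟧)      ∎
        where open ≤-Reasoning

    J-reducedWord : ∀ {u} → InWJ u → ∃ λ js → All J js × JReduced js × ⟦ js ⟧ ≈ u
    J-reducedWord {u} (ws , J-ws , ⟦ws⟧≈u)
      with ℕ-least em (λ n → ∃ λ js → All J js × length js ≡ n × ⟦ js ⟧ ≈ u) (ws , J-ws , ≡.refl , ⟦ws⟧≈u)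
    ... | _ , (js , J-js , ≡.refl , ⟦js⟧≈u) , minimal =
      js , J-js ,
      (λ ks J-ks ⟦ks⟧≈⟦js⟧ → minimal (length ks) (ks , J-ks , ≡.refl , trans ⟦ks⟧≈⟦js⟧ ⟦js⟧≈u)) ,
      ⟦js⟧≈u

    module _ (i : I) where
      open LeftMultiplication i

      minimal-descent⇒coset-descent : ∀ {m w} → MinimalInCoset m → Descent m → m ∼ w → Descent w
      minimal-descent⇒coset-descent {m} {w} m-min descent m∼w with J-reducedWord m∼w
      ... | js , J-js , js-reduced , ⟦js⟧≈m⁻¹w = begin-strict
        ℓ (sᵢ ∙ w)                ≡⟨ ℓ-cong (∙-congˡ (sym m⟦js⟧≈w)) ⟩
        ℓ (sᵢ ∙ (m ∙ ⟦ js ⟧))     ≡⟨ ℓ-cong (sym (assoc _ _ _)) ⟩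
        ℓ (sᵢ ∙ m ∙ ⟦ js ⟧)       ≤⟨ ℓ-∙-⟦⟧ (sᵢ ∙ m) js ⟩
        ℓ (sᵢ ∙ m) + length js    <⟨ +-monoˡ-< (length js) descent ⟩
        ℓ m + length js           ≤⟨ ℓ-minimal∙J m-min J-js js-reduced ⟩
        ℓ (m ∙ ⟦ js ⟧)            ≡⟨ ℓ-cong m⟦js⟧≈w ⟩
        ℓ w                       ∎
        where
        open ≤-Reasoning
        m⟦js⟧≈w : m ∙ ⟦ js ⟧ ≈ w
        m⟦js⟧≈w = trans (∙-congˡ ⟦js⟧≈m⁻¹w) (\\-leftDividesˡ m w)

      coset-descent : ∀ {τ w} → CosetLe C J (sᵢ ∙ τ) τ → ¬ (sᵢ ∙ τ ∼ τ) → τ ∼ w → Descent w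
      coset-descent {τ} (r , r′ , (sᵢτ∼r , r-min) , (τ∼r′ , r′-min) , r≤r′) sᵢτ≁τ τ∼w =
        minimal-descent⇒coset-descent sᵢr-min sᵢr-descent (∼-trans (∼-sym τ∼sᵢr) τ∼w)
        where
        r<r′ : ℓ r < ℓ r′
        r<r′ = <ᴮ⇒ℓ< (r≤r′ , λ r≈r′ → sᵢτ≁τ (∼-trans (∼-resp sᵢτ∼r r≈r′) (∼-sym τ∼r′)))
        τ∼sᵢr : τ ∼ sᵢ ∙ r
        τ∼sᵢr = ∼-trans (∼-reflexive (sym (gen-gen i τ))) (∼-∙ˡ sᵢ sᵢτ∼r)
        ℓ-r′≤ : ∀ z → τ ∼ z → ℓ r′ ≤ ℓ z
        ℓ-r′≤ z τ∼z = LenLe⇒ℓ≤ (r′-min z τ∼z)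
        sᵢr-min : MinimalInCoset (sᵢ ∙ r)
        sᵢr-min z sᵢr∼z = ≤-trans (ℓ-sᵢ∙ r) (≤-trans r<r′ (ℓ-r′≤ z (∼-trans τ∼sᵢr sᵢr∼z)))
        sᵢr-descent : Descent (sᵢ ∙ r)
        sᵢr-descent = ≡.subst (_< ℓ (sᵢ ∙ r)) (ℓ-cong (sym (gen-gen i r))) (<-≤-trans r<r′ (ℓ-r′≤ (sᵢ ∙ r) τ∼sᵢr))

lemma3p13 : ExcludedMiddle 0ℓ →
    {I : Set} (M : CoxeterMatrix I) (C : CoxeterSystem I M) →
    (J : Pred I 0ℓ) (v : Elt C) (i : I) (τ : Elt C) →
    _<B_ C v (mul C (s C i) v) →
    CosetLe C J (mul C (s C i) v) τ →
    CosetLe C J (mul C (s C i) τ) τ →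
    (y w : Elt C) →
    IsUp C J (mul C (s C i) v) τ y →
    IsUp C J v τ w →
    Eq C y w
    ⊎ (Eq C y (mul C (s C i) w) × _<B_ C w (mul C (s C i) w) × SameCoset C J (mul C (s C i) τ) τ)
-- The hypothesis svW_J ≤ τ only guarantees the existence of y, which is given here.
lemma3p13 em M C J v i τ v<sᵢv _ sᵢτ≤τ y w ((sᵢv≤y , y∼τ) , y-least) ((v≤w , w∼τ) , w-least) = up-step
  where
  open Coxeter em C
  open LeftMultiplication i
  open Parabolic J
  open Group (CoxeterSystem.W C) using (_≈_; _∙_)

  ascent-v : Ascent v
  ascent-v = <ᴮ⇒ℓ< v<sᵢv

  w≤y : w ≤ᴮ y
  w≤y = w-least y (≤ᴮ-trans (proj₁ v<sᵢv) sᵢv≤y) y∼τ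

  up-step : y ≈ w ⊎ (y ≈ sᵢ ∙ w × _<B_ C w (sᵢ ∙ w) × sᵢ ∙ τ ∼ τ)
  up-step with ascent⊎descent w
  ... | inj₂ descent-w = inj₁ (≤ᴮ-antisym (y-least w (proj₂ (lifting v≤w ascent-v) descent-w) w∼τ) w≤y)
  ... | inj₁ ascent-w with em {sᵢ ∙ τ ∼ τ}
  ...   | no sᵢτ≁τ  = ⊥-elim (<-asym ascent-w (coset-descent i sᵢτ≤τ sᵢτ≁τ (∼-sym w∼τ)))
  ...   | yes sᵢτ∼τ with ≤ᴮ-cover w≤y (y-least (sᵢ ∙ w) (proj₁ (lifting v≤w ascent-v) ascent-w)
                                              (∼-trans (∼-∙ˡ sᵢ w∼τ) sᵢτ∼τ))
                                    (ascent-ℓ ascent-w)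
  ...     | inj₁ y≈w   = inj₁ y≈w
  ...     | inj₂ y≈sᵢw = inj₂ (y≈sᵢw , ascent-<ᴮ ascent-w , sᵢτ∼τ)
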